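{- Let $p$ be a $3\bmod 4$ prime. The subgroup $G_p$ of the group $(\Omega_2,\oplus)$ generated by the $p$-clocks $[p,0],[p,1],\dots,[p,p-1]$ has order $2^p$ and is isomorphic to the group $(\{0,1\}^p,+_2)$, where $+_2$ is componentwise addition modulo $2$.
   Context: $\mathbb{N}=\{0,1,2,\dots\}$. For a prime $p$ and integer $0\le t\le p-1$, the prime clock $[p,t]:\mathbb{N}\to\mathbb{N}$ is $[p,t](m)=(m+t)\bmod p$; it is regarded as an element of $\Omega_2$ (the set of functions $\mathbb{N}\to\mathbb{Z}_2$) via $m\mapsto [p,t](m)\bmod 2$. $(\Omega_2,\oplus)$ is the abelian group with pointwise addition modulo $2$: $(f\oplus g)(m)=(f(m)+g(m))\bmod 2$. An odd prime $p$ is a $3\bmod 4$ prime if $(p-1)/2$ is odd. -}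

module Defs where

open import Data.Nat using (ℕ; zero; suc; _+_; _∸_; _^_)
open import Data.Nat.DivMod using (_%_; _/_)
open import Data.Nat.Primality using (Prime)
open import Data.Bool using (Bool; true; false; _xor_)
open import Data.Fin using (Fin; toℕ)
open import Data.Product using (Σ; _×_; ∃)
open import Relation.Binary.PropositionalEquality using (_≡_)

-- Ω₂ : functions ℕ → ℤ₂, with ℤ₂ represented by Bool (false = 0, true = 1)
Ω₂ : Set
Ω₂ = ℕ → Bool

mod2 : ℕ → Bool
mod2 n with n % 2
... | zero = false
... | suc _ = true

_⊕_ : Ω₂ → Ω₂ → Ω₂
(f ⊕ g) m = f m xor g m

𝟘 : Ω₂
𝟘 _ = false

_≈_ : Ω₂ → Ω₂ → Set
f ≈ g = ∀ m → f m ≡ g m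

-- prime clock [p,t] viewed in Ω₂ : m ↦ ((m + t) mod p) mod 2.
-- (for p = 0 the value is irrelevant; all uses have p prime)
clock : ℕ → ℕ → Ω₂
clock zero    t m = false
clock (suc q) t m = mod2 ((m + t) % suc q)

-- p is a 3 mod 4 prime: odd prime with (p-1)/2 odd
Prime3mod4 : ℕ → Set
Prime3mod4 p = Prime p × (p % 2 ≡ 1) × (((p ∸ 1) / 2) % 2 ≡ 1)

-- G p : the subgroup of (Ω₂, ⊕) generated by the clocks [p,0], …, [p,p-1],
-- as the inductively generated membership predicate (closure under identity,
-- generators, ⊕ and inverses; inverses in Ω₂ are f ↦ f itself).
data G (p : ℕ) : Ω₂ → Set where
  g-zero : G p 𝟘
  g-gen  : (t : Fin p) → G p (clock p (toℕ t))
  g-op   : ∀ {f g} → G p f → G p g → G p (f ⊕ g)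

Z2^ : ℕ → Set
Z2^ p = Fin p → Bool

_+₂_ : ∀ {p} → Z2^ p → Z2^ p → Z2^ p
(x +₂ y) i = x i xor y i

_≈ᵥ_ : ∀ {p} → Z2^ p → Z2^ p → Set
x ≈ᵥ y = ∀ i → x i ≡ y i

HasOrder : ℕ → (Ω₂ → Set) → Set
HasOrder n H =
  Σ (Fin n → Ω₂) λ e →
    (∀ i → H (e i)) ×
    (∀ i j → e i ≈ e j → i ≡ j) ×
    (∀ f → H f → ∃ λ i → e i ≈ f)

IsoZ2^ : ℕ → (Ω₂ → Set) → Set
IsoZ2^ p H =
  Σ (Z2^ p → Ω₂) λ φ →
    (∀ x → H (φ x)) ×
    (∀ x y → x ≈ᵥ y → φ x ≈ φ y) ×
    (∀ x y → φ (x +₂ y) ≈ (φ x ⊕ φ y)) ×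
    (∀ x y → φ x ≈ φ y → x ≈ᵥ y) ×
    (∀ f → H f → ∃ λ x → φ x ≈ f)

-- The sum of all p clocks is the parity count of 0, 1, …, p − 1, that is (p − 1)/2 mod 2;
-- for p ≡ 3 mod 4 it is the constant 1.  Two consecutive clocks [p,s] and [p,s+1] differ
-- everywhere except where [p,s] wraps from p − 1 (even) to 0, so adding the constant 1
-- to their sum gives the indicator of a single residue class mod p.  These p indicators
-- lie in G_p and are a basis of the p-periodic functions, while every element of G_p is
-- p-periodic; hence G_p is the group of p-periodic functions, i.e. a copy of ℤ₂^p.
module Submission where

open import Defs
open import Data.Nat using (ℕ; _^_)
open import Data.Product using (_×_)

open import Algebra.Bundles using (CommutativeMonoid; CommutativeRing)
open import Data.Bool using (Bool; true; false; not; _xor_; _∧_; if_then_else_)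
open import Data.Bool.Properties
  using (xor-∧-commutativeRing; xor-comm; xor-assoc; xor-inverseʳ; xor-identityʳ;
         not-involutive; ∧-identityʳ; ∧-zeroʳ)
open import Data.Fin
  using (Fin; zero; suc; toℕ; fromℕ<; fromℕ; inject₁; opposite; punchIn; _≟_;
         finToFun; funToFin; combine)
open import Data.Fin.Properties
  using (toℕ<n; toℕ-fromℕ<; toℕ-injective; toℕ-inject₁; toℕ-fromℕ; opposite-prop;
         punchInᵢ≢i; 2↔Bool; finToFun-funToFin; funToFin-finToFin)
open import Data.Nat using (zero; suc; _+_; _*_; _∸_; _≤_; s≤s; s≤s⁻¹; NonZero)
open import Data.Nat.DivMod
open import Data.Nat.Properties
  using (≤-refl; +-comm; +-assoc; +-suc; +-identityʳ; m∸n+n≡m; m+[n∸m]≡n; ≤∧≢⇒<)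
  renaming (_≟_ to _≟ℕ_)
open import Data.Product using (_,_; ∃)
open import Function using (_∘_)
open import Function.Bundles using (Inverse; _⇔_; mk⇔)
open import Relation.Binary.PropositionalEquality
open import Relation.Nullary using (does; yes; no)
open import Relation.Nullary.Decidable using (does-⇔; dec-true; dec-false)

xor-commutativeMonoid : CommutativeMonoid _ _
xor-commutativeMonoid = CommutativeRing.+-commutativeMonoid xor-∧-commutativeRing

open import Algebra.Properties.CommutativeMonoid.Sum xor-commutativeMonoid
  using (sum-syntax; sum-cong-≗; sum-init-last; sum-remove; sum-replicate-zero)

∑-∧-does-≟ : ∀ {n} (x : Fin n → Bool) i → ∑[ j < n ] (x j ∧ does (i ≟ j)) ≡ x i
∑-∧-does-≟ {suc n} x i = begin
    ∑[ j < suc n ] (x j ∧ does (i ≟ j))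
  ≡⟨ sum-remove {i = i} (λ j → x j ∧ does (i ≟ j)) ⟩
    (x i ∧ does (i ≟ i)) xor ∑[ j < n ] (x (punchIn i j) ∧ does (i ≟ punchIn i j))
  ≡⟨ cong₂ _xor_ (cong (x i ∧_) (dec-true (i ≟ i) refl))
                 (trans (sum-cong-≗ {n} off-diagonal) (sum-replicate-zero n)) ⟩
    (x i ∧ true) xor false
  ≡⟨ trans (xor-identityʳ _) (∧-identityʳ (x i)) ⟩
    x i
  ∎
  where
  open ≡-Reasoning
  off-diagonal : ∀ j → (x (punchIn i j) ∧ does (i ≟ punchIn i j)) ≡ false
  off-diagonal j = trans (cong (x (punchIn i j) ∧_)
                               (dec-false (i ≟ punchIn i j) (punchInᵢ≢i i j ∘ sym)))
                         (∧-zeroʳ _)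

∑-shift-periodic : ∀ n (h : ℕ → Bool) → (∀ k → h (k + n) ≡ h k) →
                   ∀ k → ∑[ t < n ] h (k + toℕ t) ≡ ∑[ t < n ] h (toℕ t)
∑-shift-periodic zero    h periodic k       = refl
∑-shift-periodic (suc n) h periodic zero    = refl
∑-shift-periodic (suc n) h periodic (suc k) =
  trans shift-by-one (∑-shift-periodic (suc n) h periodic k)
  where
  open ≡-Reasoning
  rest : Bool
  rest = ∑[ t < n ] h (k + suc (toℕ t))

  shift-by-one : ∑[ t < suc n ] h (suc k + toℕ t) ≡ ∑[ t < suc n ] h (k + toℕ t)
  shift-by-one = begin
      ∑[ t < suc n ] h (suc k + toℕ t)
    ≡⟨ sum-init-last {n} (λ t → h (suc k + toℕ t)) ⟩
      ∑[ t < n ] h (suc k + toℕ (inject₁ t)) xor h (suc k + toℕ (fromℕ n))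
    ≡⟨ cong₂ _xor_ (sum-cong-≗ {n} λ t → cong h (trans (cong (suc k +_) (toℕ-inject₁ t))
                                                       (sym (+-suc k (toℕ t)))))
                   (cong h (trans (cong (suc k +_) (toℕ-fromℕ n)) (sym (+-suc k n)))) ⟩
      rest xor h (k + suc n)
    ≡⟨ cong (rest xor_) (trans (periodic k) (cong h (sym (+-identityʳ k)))) ⟩
      rest xor h (k + 0)
    ≡⟨ xor-comm rest (h (k + 0)) ⟩
      ∑[ t < suc n ] h (k + toℕ t)
    ∎

mod2-suc : ∀ n → mod2 (suc n) ≡ not (mod2 n)
mod2-suc zero          = refl
mod2-suc (suc zero)    = refl
mod2-suc (suc (suc n)) = mod2-suc n

mod2-even : ∀ n → n % 2 ≡ 0 → mod2 n ≡ false
mod2-even n _ with n % 2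
... | zero = refl

mod2-odd : ∀ n → n % 2 ≡ 1 → mod2 n ≡ true
mod2-odd n n%2≡1 with n % 2
mod2-odd n () | zero
... | suc _ = refl

[1+m]%2≡1⇒m%2≡0 : ∀ m → suc m % 2 ≡ 1 → m % 2 ≡ 0
[1+m]%2≡1⇒m%2≡0 zero          _ = refl
[1+m]%2≡1⇒m%2≡0 (suc (suc m)) e = [1+m]%2≡1⇒m%2≡0 m e

∑-mod2-run : ∀ k a → ∑[ r < k * 2 ] mod2 (a + toℕ r) ≡ mod2 k
∑-mod2-run zero    a = refl
∑-mod2-run (suc k) a = begin
    mod2 (a + 0) xor (mod2 (a + 1) xor ∑[ r < k * 2 ] mod2 (a + suc (suc (toℕ r))))
  ≡⟨ cong₂ _xor_ (cong mod2 (+-identityʳ a))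
       (cong₂ _xor_ (trans (cong mod2 (+-comm a 1)) (mod2-suc a))
                    (trans (sum-cong-≗ {k * 2} λ r → cong mod2 (a+2+r r))
                           (∑-mod2-run k (suc (suc a))))) ⟩
    mod2 a xor (not (mod2 a) xor mod2 k)
  ≡⟨ sym (xor-assoc (mod2 a) (not (mod2 a)) (mod2 k)) ⟩
    (mod2 a xor not (mod2 a)) xor mod2 k
  ≡⟨ cong (_xor mod2 k) (xor-inverseʳ (mod2 a)) ⟩
    not (mod2 k)
  ≡⟨ sym (mod2-suc k) ⟩
    mod2 (suc k)
  ∎
  where
  open ≡-Reasoning
  a+2+r : ∀ r → a + suc (suc (toℕ r)) ≡ suc (suc a) + toℕ r
  a+2+r r = trans (+-suc a _) (cong suc (+-suc a (toℕ r)))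

%-cong-+ : ∀ {a b c d} n .{{_ : NonZero n}} → a % n ≡ b % n → c % n ≡ d % n →
           (a + c) % n ≡ (b + d) % n
%-cong-+ {a} {b} {c} {d} n a≡b c≡d = begin
  (a + c) % n            ≡⟨ %-distribˡ-+ a c n ⟩
  (a % n + c % n) % n    ≡⟨ cong₂ (λ x y → (x + y) % n) a≡b c≡d ⟩
  (b % n + d % n) % n    ≡⟨ %-distribˡ-+ b d n ⟨
  (b + d) % n            ∎
  where open ≡-Reasoning

funToFin-cong : ∀ {m n} {f g : Fin m → Fin n} → (∀ i → f i ≡ g i) → funToFin f ≡ funToFin g
funToFin-cong {zero}  _   = refl
funToFin-cong {suc m} f≗g = cong₂ combine (f≗g zero) (funToFin-cong (f≗g ∘ suc))

module _ {n : ℕ} where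
  open Inverse 2↔Bool using (to; from; strictlyInverseˡ; strictlyInverseʳ)

  decode : Fin (2 ^ n) → Z2^ n
  decode i = to ∘ finToFun i

  encode : Z2^ n → Fin (2 ^ n)
  encode x = funToFin (from ∘ x)

  decode-encode : ∀ x → decode (encode x) ≈ᵥ x
  decode-encode x i = trans (cong to (finToFun-funToFin (from ∘ x) i)) (strictlyInverseˡ (x i))

  decode-injective : ∀ i j → decode i ≈ᵥ decode j → i ≡ j
  decode-injective i j i≈j = begin
    i                                ≡⟨ funToFin-finToFin {n} i ⟨
    funToFin (finToFun {2} {n} i)    ≡⟨ funToFin-cong finToFun-i≗finToFun-j ⟩
    funToFin (finToFun {2} {n} j)    ≡⟨ funToFin-finToFin {n} j ⟩
    j                                ∎
    where
    open ≡-Reasoning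
    finToFun-i≗finToFun-j : ∀ k → finToFun i k ≡ finToFun j k
    finToFun-i≗finToFun-j k =
      trans (sym (strictlyInverseʳ _)) (trans (cong from (i≈j k)) (strictlyInverseʳ _))

IsoZ2^⇒HasOrder : ∀ p H → IsoZ2^ p H → HasOrder (2 ^ p) H
IsoZ2^⇒HasOrder p H (φ , φ∈H , φ-cong , _ , φ-injective , φ-onto) =
    φ ∘ decode
  , φ∈H ∘ decode
  , (λ i j φi≈φj → decode-injective i j (φ-injective _ _ φi≈φj))
  , λ f f∈H → let (x , φx≈f) = φ-onto f f∈H in
      encode x , λ m → trans (φ-cong _ _ (decode-encode x) m) (φx≈f m)

⨁ : ∀ {n} → (Fin n → Ω₂) → Ω₂
⨁ {n} f m = ∑[ i < n ] f i m

_·_ : Bool → Ω₂ → Ω₂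
b · f = if b then f else 𝟘

·-apply : ∀ b f m → (b · f) m ≡ b ∧ f m
·-apply true  f m = refl
·-apply false f m = refl

module _ {p : ℕ} where

  ⨁-closed : ∀ {n} (f : Fin n → Ω₂) → (∀ i → G p (f i)) → G p (⨁ f)
  ⨁-closed {zero}  f f∈G = g-zero
  ⨁-closed {suc n} f f∈G = g-op (f∈G zero) (⨁-closed (f ∘ suc) (f∈G ∘ suc))

  ·-closed : ∀ b {f} → G p f → G p (b · f)
  ·-closed true  f∈G = f∈G
  ·-closed false f∈G = g-zero

module Clocks (q : ℕ) where

  P : ℕ
  P = suc q

  residue : ℕ → Fin P
  residue m = fromℕ< (m%n<n m P)

  toℕ-residue : ∀ m → toℕ (residue m) ≡ m % P
  toℕ-residue m = toℕ-fromℕ< (m%n<n m P)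

  residue-toℕ : ∀ r → residue (toℕ r) ≡ r
  residue-toℕ r = toℕ-injective (trans (toℕ-residue (toℕ r)) (m<n⇒m%n≡m (toℕ<n r)))

  [m%P+n]%P≡[m+n]%P : ∀ m n → (m % P + n) % P ≡ (m + n) % P
  [m%P+n]%P≡[m+n]%P m n = %-cong-+ {m % P} {m} {n} {n} P (m%n%n≡m%n m P) refl

  [m+n%P]%P≡[m+n]%P : ∀ m n → (m + n % P) % P ≡ (m + n) % P
  [m+n%P]%P≡[m+n]%P m n = %-cong-+ {m} {m} {n % P} {n} P refl (m%n%n≡m%n n P)

  G-periodic : ∀ {f} → G P f → ∀ m → f (m % P) ≡ f m
  G-periodic g-zero      m = refl
  G-periodic (g-gen t)   m = cong mod2 ([m%P+n]%P≡[m+n]%P m (toℕ t))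
  G-periodic (g-op f g)  m = cong₂ _xor_ (G-periodic f m) (G-periodic g m)

  allClocks : Ω₂
  allClocks = ⨁ {P} (clock P ∘ toℕ)

  allClocks-true : q % 2 ≡ 0 → q / 2 % 2 ≡ 1 → ∀ m → allClocks m ≡ true
  allClocks-true q-even half-odd m = begin
      allClocks m
    ≡⟨⟩
      ∑[ t < P ] mod2 ((m + toℕ t) % P)
    ≡⟨ ∑-shift-periodic P (λ k → mod2 (k % P)) (λ k → cong mod2 ([m+n]%n≡m%n k P)) m ⟩
      ∑[ t < P ] mod2 (toℕ t % P)
    ≡⟨ sum-cong-≗ {P} (λ t → cong mod2 (m<n⇒m%n≡m (toℕ<n t))) ⟩
      ∑[ t < P ] mod2 (toℕ t)
    ≡⟨⟩
      mod2 0 xor ∑[ r < q ] mod2 (1 + toℕ r)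
    ≡⟨ cong (λ n → ∑[ r < n ] mod2 (1 + toℕ r)) q≡[q/2]*2 ⟩
      ∑[ r < q / 2 * 2 ] mod2 (1 + toℕ r)
    ≡⟨ ∑-mod2-run (q / 2) 1 ⟩
      mod2 (q / 2)
    ≡⟨ mod2-odd (q / 2) half-odd ⟩
      true
    ∎
    where
    open ≡-Reasoning
    q≡[q/2]*2 : q ≡ q / 2 * 2
    q≡[q/2]*2 = trans (m≡m%n+[m/n]*n q 2) (cong (_+ q / 2 * 2) q-even)

  mod2-wrap : q % 2 ≡ 0 → ∀ k → mod2 (k % P) xor mod2 (suc k % P) ≡ not (does (k % P ≟ℕ q))
  mod2-wrap q-even k with k % P ≟ℕ q
  ... | yes k%P≡q = begin
      mod2 (k % P) xor mod2 (suc k % P)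
    ≡⟨ cong₂ _xor_ (cong mod2 k%P≡q)
                   (cong mod2 (trans (sym ([m+n%P]%P≡[m+n]%P 1 k))
                                     (cong (λ r → suc r % P) k%P≡q))) ⟩
      mod2 q xor mod2 (P % P)
    ≡⟨ cong₂ _xor_ (mod2-even q q-even) (cong mod2 (n%n≡0 P)) ⟩
      false
    ≡⟨ cong not (dec-true (k % P ≟ℕ q) k%P≡q) ⟨
      not (does (k % P ≟ℕ q))
    ∎
    where open ≡-Reasoning
  ... | no k%P≢q = begin
      mod2 (k % P) xor mod2 (suc k % P)
    ≡⟨ cong (mod2 (k % P) xor_)
            (cong mod2 (trans (sym ([m+n%P]%P≡[m+n]%P 1 k))
                              (m<n⇒m%n≡m (s≤s (≤∧≢⇒< (s≤s⁻¹ (m%n<n k P)) k%P≢q))))) ⟩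
      mod2 (k % P) xor mod2 (suc (k % P))
    ≡⟨ cong (mod2 (k % P) xor_) (mod2-suc (k % P)) ⟩
      mod2 (k % P) xor not (mod2 (k % P))
    ≡⟨ xor-inverseʳ (mod2 (k % P)) ⟩
      true
    ≡⟨ cong not (dec-false (k % P ≟ℕ q) k%P≢q) ⟨
      not (does (k % P ≟ℕ q))
    ∎
    where open ≡-Reasoning

  wraps⇔residue : ∀ m r → (m + toℕ (opposite r)) % P ≡ q ⇔ residue m ≡ r
  wraps⇔residue m r rewrite opposite-prop r = mk⇔ to from
    where
    open ≡-Reasoning
    r≤q : toℕ r ≤ q
    r≤q = s≤s⁻¹ (toℕ<n r)
    q%P≡q : q % P ≡ q
    q%P≡q = m<n⇒m%n≡m ≤-refl

    to : (m + (q ∸ toℕ r)) % P ≡ q → residue m ≡ r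
    to wraps = toℕ-injective (begin
      toℕ (residue m)                     ≡⟨ toℕ-residue m ⟩
      m % P                               ≡⟨ [m+n]%n≡m%n m P ⟨
      (m + P) % P                         ≡⟨ cong (λ n → (m + n) % P) P≡[q∸r]+1+r ⟩
      (m + (q ∸ toℕ r + suc (toℕ r))) % P ≡⟨ cong (_% P) (+-assoc m _ _) ⟨
      (m + (q ∸ toℕ r) + suc (toℕ r)) % P ≡⟨ %-cong-+ {m + (q ∸ toℕ r)} {q} {suc (toℕ r)} P
                                                         (trans wraps (sym q%P≡q)) refl ⟩
      (q + suc (toℕ r)) % P               ≡⟨ cong (_% P) (trans (+-suc q (toℕ r)) (+-comm P (toℕ r))) ⟩
      (toℕ r + P) % P                     ≡⟨ [m+n]%n≡m%n (toℕ r) P ⟩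
      toℕ r % P                           ≡⟨ m<n⇒m%n≡m (toℕ<n r) ⟩
      toℕ r                               ∎)
      where
      P≡[q∸r]+1+r : P ≡ q ∸ toℕ r + suc (toℕ r)
      P≡[q∸r]+1+r = sym (trans (+-suc (q ∸ toℕ r) (toℕ r)) (cong suc (m∸n+n≡m r≤q)))

    from : residue m ≡ r → (m + (q ∸ toℕ r)) % P ≡ q
    from residue≡r = begin
      (m + (q ∸ toℕ r)) % P       ≡⟨ [m%P+n]%P≡[m+n]%P m (q ∸ toℕ r) ⟨
      (m % P + (q ∸ toℕ r)) % P   ≡⟨ cong (λ n → (n + (q ∸ toℕ r)) % P) m%P≡r ⟩
      (toℕ r + (q ∸ toℕ r)) % P   ≡⟨ cong (_% P) (m+[n∸m]≡n r≤q) ⟩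
      q % P                       ≡⟨ q%P≡q ⟩
      q                           ∎
      where
      m%P≡r : m % P ≡ toℕ r
      m%P≡r = trans (sym (toℕ-residue m)) (cong toℕ residue≡r)

  successor : Fin P → Fin P
  successor s = residue (suc (toℕ s))

  wrapIndicator : Fin P → Ω₂
  wrapIndicator s = allClocks ⊕ (clock P (toℕ s) ⊕ clock P (toℕ (successor s)))

  indicator : Fin P → Ω₂
  indicator r = wrapIndicator (opposite r)

  indicator∈G : ∀ r → G P (indicator r)
  indicator∈G r = g-op (⨁-closed (clock P ∘ toℕ) g-gen) (g-op (g-gen _) (g-gen _))

  extend : Z2^ P → Ω₂
  extend x = ⨁ (λ r → x r · indicator r)

  extend∈G : ∀ x → G P (extend x)
  extend∈G x = ⨁-closed _ (λ r → ·-closed (x r) (indicator∈G r))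

  module _ (q-even : q % 2 ≡ 0) (half-odd : q / 2 % 2 ≡ 1) where

    wrapIndicator-apply : ∀ s m → wrapIndicator s m ≡ does ((m + toℕ s) % P ≟ℕ q)
    wrapIndicator-apply s m = begin
        allClocks m xor (mod2 (k % P) xor mod2 ((m + toℕ (successor s)) % P))
      ≡⟨ cong₂ _xor_ (allClocks-true q-even half-odd m)
                     (cong (λ n → mod2 (k % P) xor mod2 n) next) ⟩
        not (mod2 (k % P) xor mod2 (suc k % P))
      ≡⟨ cong not (mod2-wrap q-even k) ⟩
        not (not (does (k % P ≟ℕ q)))
      ≡⟨ not-involutive _ ⟩
        does (k % P ≟ℕ q)
      ∎
      where
      open ≡-Reasoning
      k : ℕ
      k = m + toℕ s
      next : (m + toℕ (successor s)) % P ≡ suc k % P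
      next = begin
        (m + toℕ (successor s)) % P   ≡⟨ cong (λ n → (m + n) % P) (toℕ-residue (suc (toℕ s))) ⟩
        (m + suc (toℕ s) % P) % P     ≡⟨ [m+n%P]%P≡[m+n]%P m (suc (toℕ s)) ⟩
        (m + suc (toℕ s)) % P         ≡⟨ cong (_% P) (+-suc m (toℕ s)) ⟩
        suc k % P                     ∎

    indicator-apply : ∀ r m → indicator r m ≡ does (residue m ≟ r)
    indicator-apply r m =
      trans (wrapIndicator-apply (opposite r) m)
            (does-⇔ (wraps⇔residue m r) ((m + toℕ (opposite r)) % P ≟ℕ q) (residue m ≟ r))

    extend-apply : ∀ x m → extend x m ≡ x (residue m)
    extend-apply x m = begin
      ∑[ r < P ] (x r · indicator r) m          ≡⟨ sum-cong-≗ {P} (λ r → ·-apply (x r) (indicator r) m) ⟩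
      ∑[ r < P ] (x r ∧ indicator r m)          ≡⟨ sum-cong-≗ {P} (λ r → cong (x r ∧_) (indicator-apply r m)) ⟩
      ∑[ r < P ] (x r ∧ does (residue m ≟ r))   ≡⟨ ∑-∧-does-≟ x (residue m) ⟩
      x (residue m)                             ∎
      where open ≡-Reasoning

    extend-apply-toℕ : ∀ x r → extend x (toℕ r) ≡ x r
    extend-apply-toℕ x r = trans (extend-apply x (toℕ r)) (cong x (residue-toℕ r))

    G≅Z2^ : IsoZ2^ P (G P)
    G≅Z2^ = extend , extend∈G , extend-cong , extend-homo , extend-injective , extend-onto
      where
      extend-cong : ∀ x y → x ≈ᵥ y → extend x ≈ extend y
      extend-cong x y x≈y m =
        trans (extend-apply x m) (trans (x≈y _) (sym (extend-apply y m)))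

      extend-homo : ∀ x y → extend (x +₂ y) ≈ (extend x ⊕ extend y)
      extend-homo x y m =
        trans (extend-apply (x +₂ y) m) (sym (cong₂ _xor_ (extend-apply x m) (extend-apply y m)))

      extend-injective : ∀ x y → extend x ≈ extend y → x ≈ᵥ y
      extend-injective x y ex≈ey r =
        trans (sym (extend-apply-toℕ x r)) (trans (ex≈ey (toℕ r)) (extend-apply-toℕ y r))

      extend-onto : ∀ f → G P f → ∃ λ x → extend x ≈ f
      extend-onto f f∈G = (f ∘ toℕ) , λ m →
        trans (extend-apply (f ∘ toℕ) m) (trans (cong f (toℕ-residue m)) (G-periodic f∈G m))

mainTheorem5 : (p : ℕ) → Prime3mod4 p → HasOrder (2 ^ p) (G p) × IsoZ2^ p (G p)
mainTheorem5 zero    (_ , () , _)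
mainTheorem5 (suc q) (_ , p-odd , half-odd) = IsoZ2^⇒HasOrder (suc q) (G (suc q)) iso , iso
  where
  iso : IsoZ2^ (suc q) (G (suc q))
  iso = Clocks.G≅Z2^ q ([1+m]%2≡1⇒m%2≡0 q p-odd) half-odd
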